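{- Let $S_1,\dots,S_8$ be the following $4$-cycle systems of $K_9$ (each cycle $abcd$ listed by its vertices in cyclic order): $S_1$: 1234, 1356, 1527, 1829, 2476, 3648, 3759, 4589, 6879; $S_2$: 1234, 1356, 1527, 1829, 2476, 3687, 3849, 4596, 5798; $S_3$: 1234, 1356, 1527, 1829, 2486, 3647, 3859, 4579, 6789; $S_4$: 1234, 1356, 1527, 1829, 2486, 3647, 3879, 4589, 5769; $S_5$: 1234, 1356, 1527, 1829, 2486, 3678, 3749, 4596, 5798; $S_6$: 1234, 1356, 1527, 1829, 2486, 3678, 3759, 4589, 4697; $S_7$: 1234, 1356, 1527, 1829, 2486, 3698, 3749, 4576, 5879; $S_8$: 1234, 1356, 1527, 1849, 2458, 2689, 3678, 3759, 4697. Let $\sigma$ be a permutation of $\{1,\dots,9\}$. If for some $i\in\{1,\dots,8\}$ there is a path of $4$-cycle bitrades of volume $2$ and $3$ between $S_i$ and $S_i^{\sigma}$, then for every $j\in\{1,\dots,8\}$, $S_j$ and $S_j^{\sigma}$ can be generated from each other by applying a sequence of $4$-cycle bitrades of volume $2$ and $3$.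
   Context: A $4$-cycle $abcd$ has vertices $a,b,c,d$ and edges $\{a,b\},\{b,c\},\{c,d\},\{d,a\}$; cycles are identified with their edge sets. A $4$-cycle system of order $9$ is a collection of $4$-cycles whose edge sets partition the edges of $K_9$ on $\{1,\dots,9\}$. A $4$-cycle bitrade $(T,T')$ of volume $s$ is a pair of disjoint sets of $s$ pairwise edge-disjoint $4$-cycles covering the same edge set. A path of bitrades of volume $2$ and $3$ between $A$ and $B$ (equivalently, $B$ is generated from $A$ by a sequence of such bitrades) is a sequence $A=C_0,\dots,C_m=B$ of $4$-cycle systems with $C_i=(C_{i-1}\setminus T)\cup T'$ for some bitrade $(T,T')$ of volume $2$ or $3$ with $T\subseteq C_{i-1}$. For a set $X$ of $4$-cycles and a permutation $\sigma$, $X^{\sigma}$ is obtained by applying $\sigma$ to every vertex of every cycle of $X$. -}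

module Defs where

open import Data.Nat using (ℕ; _∸_)
open import Data.Nat.DivMod using (_mod_)
open import Data.Fin using (Fin)
open import Data.Fin.Properties using (_≟_)
open import Data.Fin.Permutation using (Permutation′; _⟨$⟩ʳ_)
open import Data.Bool using (Bool; true; _∧_; _∨_)
open import Data.Vec using (Vec; lookup; tabulate)
open import Data.List using (List; []; _∷_; map; length)
open import Data.List.Membership.Propositional using (_∈_; _∉_)
open import Data.List.Relation.Unary.All using (All)
open import Data.List.Relation.Unary.Any using (Any)
open import Data.List.Relation.Unary.AllPairs using (AllPairs)
open import Data.Product using (Σ; _×_; _,_; ∃; Σ-syntax; ∃-syntax)
open import Data.Sum using (_⊎_)
open import Data.Empty using (⊥)
open import Relation.Nullary using (¬_)
open import Relation.Nullary.Decidable using (⌊_⌋)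
open import Relation.Binary.PropositionalEquality using (_≡_; _≢_)
open import Relation.Binary.Construct.Closure.ReflexiveTransitive using (Star)
open import Function.Bundles using (_⇔_)

-- Vertices 1..9 of K₉ are represented by Fin 9 (vertex k ↦ k-1).
V : Set
V = Fin 9

-- A set of edges of K₉, as a (symmetric) adjacency matrix.
-- A 4-cycle is identified with its edge set, i.e. with such a matrix,
-- so equality of cycles is propositional equality of edge sets.
EdgeSet : Set
EdgeSet = Vec (Vec Bool 9) 9

HasEdge : EdgeSet → V → V → Set
HasEdge C x y = lookup (lookup C x) y ≡ true

sameEdge : V → V → V → V → Bool
sameEdge x y u w = (⌊ x ≟ u ⌋ ∧ ⌊ y ≟ w ⌋) ∨ (⌊ x ≟ w ⌋ ∧ ⌊ y ≟ u ⌋)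

cyc : V → V → V → V → EdgeSet
cyc a b c d = tabulate λ x → tabulate λ y →
  sameEdge x y a b ∨ sameEdge x y b c ∨ sameEdge x y c d ∨ sameEdge x y d a

IsFourCycle : EdgeSet → Set
IsFourCycle C = Σ[ a ∈ V ] Σ[ b ∈ V ] Σ[ c ∈ V ] Σ[ d ∈ V ]
  (a ≢ b × a ≢ c × a ≢ d × b ≢ c × b ≢ d × c ≢ d) × C ≡ cyc a b c d

-- Finite sets of 4-cycles are represented by lists (set semantics via ∈).
CycleList : Set
CycleList = List EdgeSet

IsSystem : CycleList → Set
IsSystem A = All IsFourCycle A ×
  (∀ x y → x ≢ y →
     (Σ[ C ∈ EdgeSet ] (C ∈ A × HasEdge C x y)) ×
     (∀ C D → C ∈ A → D ∈ A → HasEdge C x y → HasEdge D x y → C ≡ D))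

EdgeDisjoint : EdgeSet → EdgeSet → Set
EdgeDisjoint C D = ∀ x y → HasEdge C x y → HasEdge D x y → ⊥

Covers : CycleList → V → V → Set
Covers T x y = Any (λ C → HasEdge C x y) T

-- A 4-cycle bitrade (T,T') of volume s: T, T' disjoint sets of s pairwise
-- edge-disjoint 4-cycles (pairwise edge-disjointness of distinct list
-- positions also forces the s listed cycles to be distinct), covering
-- the same edge set.
IsBitrade : ℕ → CycleList → CycleList → Set
IsBitrade s T T' =
  All IsFourCycle T × All IsFourCycle T' ×
  length T ≡ s × length T' ≡ s ×
  AllPairs EdgeDisjoint T × AllPairs EdgeDisjoint T' ×
  (∀ C → C ∈ T → C ∉ T') ×
  (∀ x y → Covers T x y ⇔ Covers T' x y)

Step : CycleList → CycleList → Set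
Step A B = Σ[ s ∈ ℕ ] Σ[ T ∈ CycleList ] Σ[ T' ∈ CycleList ]
  (s ≡ 2 ⊎ s ≡ 3) × IsBitrade s T T' ×
  (∀ C → C ∈ T → C ∈ A) × IsSystem B ×
  (∀ C → C ∈ B ⇔ ((C ∈ A × C ∉ T) ⊎ C ∈ T'))

Path : CycleList → CycleList → Set
Path A B = Σ[ C ∈ CycleList ] Star Step A C × (∀ X → X ∈ C ⇔ X ∈ B)

Quad : Set
Quad = ℕ × ℕ × ℕ × ℕ

toV : ℕ → V
toV n = (n ∸ 1) mod 9

quads : Fin 8 → List Quad
quads Fin.zero = (1 , 2 , 3 , 4) ∷ (1 , 3 , 5 , 6) ∷ (1 , 5 , 2 , 7) ∷ (1 , 8 , 2 , 9) ∷ (2 , 4 , 7 , 6) ∷ (3 , 6 , 4 , 8) ∷ (3 , 7 , 5 , 9) ∷ (4 , 5 , 8 , 9) ∷ (6 , 8 , 7 , 9) ∷ []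
quads (Fin.suc Fin.zero) = (1 , 2 , 3 , 4) ∷ (1 , 3 , 5 , 6) ∷ (1 , 5 , 2 , 7) ∷ (1 , 8 , 2 , 9) ∷ (2 , 4 , 7 , 6) ∷ (3 , 6 , 8 , 7) ∷ (3 , 8 , 4 , 9) ∷ (4 , 5 , 9 , 6) ∷ (5 , 7 , 9 , 8) ∷ []
quads (Fin.suc (Fin.suc Fin.zero)) = (1 , 2 , 3 , 4) ∷ (1 , 3 , 5 , 6) ∷ (1 , 5 , 2 , 7) ∷ (1 , 8 , 2 , 9) ∷ (2 , 4 , 8 , 6) ∷ (3 , 6 , 4 , 7) ∷ (3 , 8 , 5 , 9) ∷ (4 , 5 , 7 , 9) ∷ (6 , 7 , 8 , 9) ∷ []
quads (Fin.suc (Fin.suc (Fin.suc Fin.zero))) = (1 , 2 , 3 , 4) ∷ (1 , 3 , 5 , 6) ∷ (1 , 5 , 2 , 7) ∷ (1 , 8 , 2 , 9) ∷ (2 , 4 , 8 , 6) ∷ (3 , 6 , 4 , 7) ∷ (3 , 8 , 7 , 9) ∷ (4 , 5 , 8 , 9) ∷ (5 , 7 , 6 , 9) ∷ []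
quads (Fin.suc (Fin.suc (Fin.suc (Fin.suc Fin.zero)))) = (1 , 2 , 3 , 4) ∷ (1 , 3 , 5 , 6) ∷ (1 , 5 , 2 , 7) ∷ (1 , 8 , 2 , 9) ∷ (2 , 4 , 8 , 6) ∷ (3 , 6 , 7 , 8) ∷ (3 , 7 , 4 , 9) ∷ (4 , 5 , 9 , 6) ∷ (5 , 7 , 9 , 8) ∷ []
quads (Fin.suc (Fin.suc (Fin.suc (Fin.suc (Fin.suc Fin.zero))))) = (1 , 2 , 3 , 4) ∷ (1 , 3 , 5 , 6) ∷ (1 , 5 , 2 , 7) ∷ (1 , 8 , 2 , 9) ∷ (2 , 4 , 8 , 6) ∷ (3 , 6 , 7 , 8) ∷ (3 , 7 , 5 , 9) ∷ (4 , 5 , 8 , 9) ∷ (4 , 6 , 9 , 7) ∷ []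
quads (Fin.suc (Fin.suc (Fin.suc (Fin.suc (Fin.suc (Fin.suc Fin.zero)))))) = (1 , 2 , 3 , 4) ∷ (1 , 3 , 5 , 6) ∷ (1 , 5 , 2 , 7) ∷ (1 , 8 , 2 , 9) ∷ (2 , 4 , 8 , 6) ∷ (3 , 6 , 9 , 8) ∷ (3 , 7 , 4 , 9) ∷ (4 , 5 , 7 , 6) ∷ (5 , 8 , 7 , 9) ∷ []
quads (Fin.suc (Fin.suc (Fin.suc (Fin.suc (Fin.suc (Fin.suc (Fin.suc Fin.zero))))))) = (1 , 2 , 3 , 4) ∷ (1 , 3 , 5 , 6) ∷ (1 , 5 , 2 , 7) ∷ (1 , 8 , 4 , 9) ∷ (2 , 4 , 5 , 8) ∷ (2 , 6 , 8 , 9) ∷ (3 , 6 , 7 , 8) ∷ (3 , 7 , 5 , 9) ∷ (4 , 6 , 9 , 7) ∷ []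

-- S_{i+1} (index i : Fin 8) with a vertex map applied.
sysMap : (V → V) → Fin 8 → CycleList
sysMap f i = map (λ { (a , b , c , d) → cyc (f (toV a)) (f (toV b)) (f (toV c)) (f (toV d)) }) (quads i)

S : Fin 8 → CycleList
S i = sysMap (λ x → x) i

Sσ : Permutation′ 9 → Fin 8 → CycleList
Sσ σ i = sysMap (σ ⟨$⟩ʳ_) i

-- Relabelling the vertices by σ sends 4-cycle systems to 4-cycle systems and bitrades to
-- bitrades, hence a path of bitrades from Sᵢ to Sⱼ to one from Sᵢ^σ to Sⱼ^σ; and a path can be
-- walked backwards by exchanging the two halves of every bitrade. Explicit bitrades of volume 3
-- join every Sⱼ to S₆, so a path Sᵢ → Sᵢ^σ extends to Sⱼ → Sᵢ → Sᵢ^σ → Sⱼ^σ.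

module Submission where

open import Defs
import Data.Nat.Properties as ℕ
open import Data.Bool using (Bool; true; _∨_)
open import Data.Bool.Properties using () renaming (_≟_ to _≟ᵇ_)
open import Data.Fin using (Fin; #_; zero; suc)
open import Data.Fin.Properties using (_≟_)
import Data.Fin.Properties as Fin
open import Data.Fin.Permutation using (Permutation′; _⟨$⟩ʳ_; _⟨$⟩ˡ_; inverseˡ; inverseʳ)
open import Data.Vec using (lookup; tabulate)
open import Data.Vec.Properties using (lookup∘tabulate; tabulate∘lookup; tabulate-cong; ≡-dec)
open import Data.List using (List; []; _∷_; map; length)
open import Data.List.Properties using (length-map; map-cong; map-∘)
open import Data.List.Membership.Propositional using (_∈_; _∉_; find; lose)
open import Data.List.Membership.Propositional.Properties using (∈-map⁺; ∈-map⁻)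
import Data.List.Membership.DecPropositional as DecMembership
open import Data.List.Relation.Binary.Subset.Propositional using (_⊆_)
open import Data.List.Relation.Binary.Subset.Propositional.Properties using () renaming (map⁺ to ⊆-map⁺)
import Data.List.Relation.Binary.Subset.DecPropositional as DecSubset
open import Data.List.Relation.Unary.All as All using (All)
import Data.List.Relation.Unary.All.Properties as All
open import Data.List.Relation.Unary.Any as Any using (here; there; any?)
import Data.List.Relation.Unary.Any.Properties as Any
open import Data.List.Relation.Unary.AllPairs as AllPairs using (AllPairs; _∷_; allPairs?)
import Data.List.Relation.Unary.AllPairs.Properties as AllPairs
open import Data.Product using (Σ-syntax; _×_; _,_; proj₁; proj₂)
open import Data.Product.Properties using () renaming (≡-dec to Σ-≡-dec)
open import Data.Product.Function.NonDependent.Propositional using (_×-⇔_)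
open import Data.Sum using (_⊎_; inj₁; inj₂; [_,_]′)
open import Data.Sum.Function.Propositional using (_⊎-⇔_)
open import Data.Empty using (⊥-elim)
open import Relation.Nullary using (Dec; does; yes; no; ¬?; _×-dec_; _⊎-dec_; _→-dec_)
open import Relation.Nullary.Decidable using (⌊_⌋; True; toWitness; map′; isYes≗does; does-⇔; dec-true)
open import Relation.Binary.PropositionalEquality using (_≡_; _≢_; refl; sym; trans; cong; cong₂; subst; subst₂; module ≡-Reasoning)
open import Relation.Binary.Construct.Closure.ReflexiveTransitive using (Star; ε; _◅_; _◅◅_; gmap)
open import Function using (_∘_; case_of_)
open import Function.Bundles using (_⇔_; mk⇔; Equivalence)
open import Function.Construct.Identity using (⇔-id)
open import Function.Construct.Symmetry using (⇔-sym)
open import Function.Construct.Composition using (_⇔-∘_)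
open import Function.Related.TypeIsomorphisms using (¬-cong-⇔)

open Equivalence using (to; from)

entry : EdgeSet → V → V → Bool
entry C x y = lookup (lookup C x) y

entry-tabulate : (F : V → V → Bool) → ∀ x y → entry (tabulate λ x → tabulate (F x)) x y ≡ F x y
entry-tabulate F x y = trans (cong (λ row → lookup row y) (lookup∘tabulate (λ x → tabulate (F x)) x)) (lookup∘tabulate (F x) y)

EdgeSet-ext : ∀ {C D} → (∀ x y → entry C x y ≡ entry D x y) → C ≡ D
EdgeSet-ext {C} {D} C≗D = begin
  C                                             ≡⟨ sym (tabulate-rows C) ⟩
  tabulate (λ x → tabulate (λ y → entry C x y)) ≡⟨ tabulate-cong (λ x → tabulate-cong (C≗D x)) ⟩
  tabulate (λ x → tabulate (λ y → entry D x y)) ≡⟨ tabulate-rows D ⟩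
  D                                             ∎
  where
  open ≡-Reasoning
  tabulate-rows : ∀ C → tabulate (λ x → tabulate (λ y → entry C x y)) ≡ C
  tabulate-rows C = trans (tabulate-cong (λ x → tabulate∘lookup (lookup C x))) (tabulate∘lookup C)

_≟ₑ_ : (C D : EdgeSet) → Dec (C ≡ D)
_≟ₑ_ = ≡-dec (≡-dec _≟ᵇ_)

open DecMembership _≟ₑ_ using () renaming (_∈?_ to _∈ₑ?_)

isYes-refl : ∀ (x : V) → ⌊ x ≟ x ⌋ ≡ true
isYes-refl x = trans (isYes≗does (x ≟ x)) (dec-true (x ≟ x) refl)

sameEdge-refl : ∀ x y → sameEdge x y x y ≡ true
sameEdge-refl x y rewrite isYes-refl x | isYes-refl y = refl

cyc-entry : ∀ a b c d x y →
  entry (cyc a b c d) x y ≡ (sameEdge x y a b ∨ sameEdge x y b c ∨ sameEdge x y c d ∨ sameEdge x y d a)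
cyc-entry a b c d = entry-tabulate (λ x y → sameEdge x y a b ∨ sameEdge x y b c ∨ sameEdge x y c d ∨ sameEdge x y d a)

cyc-has-first-edge : ∀ a b c d → HasEdge (cyc a b c d) a b
cyc-has-first-edge a b c d = trans (cyc-entry a b c d a b) (cong (_∨ (sameEdge a b b c ∨ sameEdge a b c d ∨ sameEdge a b d a)) (sameEdge-refl a b))

IsFourCycle⇒HasEdge : ∀ {C} → IsFourCycle C → Σ[ a ∈ V ] Σ[ b ∈ V ] (a ≢ b × HasEdge C a b)
IsFourCycle⇒HasEdge (a , b , c , d , (a≢b , _) , refl) = a , b , a≢b , cyc-has-first-edge a b c d

_≈_ : CycleList → CycleList → Set
A ≈ B = ∀ X → X ∈ A ⇔ X ∈ B

≈-refl : ∀ {A} → A ≈ A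
≈-refl X = ⇔-id _

≈-sym : ∀ {A B} → A ≈ B → B ≈ A
≈-sym A≈B X = ⇔-sym (A≈B X)

≈-trans : ∀ {A B C} → A ≈ B → B ≈ C → A ≈ C
≈-trans A≈B B≈C X = B≈C X ⇔-∘ A≈B X

Step-respˡ-≈ : ∀ {A A′ B} → A ≈ A′ → Step A B → Step A′ B
Step-respˡ-≈ A≈A′ (s , T , T′ , vol , bitrade , T⊆A , sysB , B≡A∖T∪T′) =
  s , T , T′ , vol , bitrade , (λ C C∈T → to (A≈A′ C) (T⊆A C C∈T)) , sysB ,
  λ C → ((A≈A′ C ×-⇔ ⇔-id _) ⊎-⇔ ⇔-id _) ⇔-∘ B≡A∖T∪T′ C

Path-respˡ-≈ : ∀ {A A′ B} → A ≈ A′ → Path A B → Path A′ B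
Path-respˡ-≈ A≈A′ (_ , ε , A≈B) = _ , ε , ≈-trans (≈-sym A≈A′) A≈B
Path-respˡ-≈ A≈A′ (C , step ◅ steps , C≈B) = C , Step-respˡ-≈ A≈A′ step ◅ steps , C≈B

Path-trans : ∀ {A B C} → Path A B → Path B C → Path A C
Path-trans (X , A→X , X≈B) q =
  let Y , X→Y , Y≈C = Path-respˡ-≈ (≈-sym X≈B) q in Y , A→X ◅◅ X→Y , Y≈C

Star⇒Path : ∀ {A B} → Star Step A B → Path A B
Star⇒Path A→B = _ , A→B , ≈-refl

IsSystem-Step : ∀ {A B} → Step A B → IsSystem B
IsSystem-Step (_ , _ , _ , _ , _ , _ , sysB , _) = sysB

-- Any cycle of A that lies in T′ shares an edge with a cycle of T ⊆ A (T and T′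
-- cover the same edges), so it is that cycle, since A partitions the edges.
Step-sym : ∀ {A B} → IsSystem A → Step A B → Step B A
Step-sym {A} {B} (fourA , partA) (s , T , T′ , vol , (fourT , fourT′ , ∣T∣ , ∣T′∣ , disjT , disjT′ , T∩T′ , cover) , T⊆A , sysB , B≡A∖T∪T′) =
  s , T′ , T , vol ,
  (fourT′ , fourT , ∣T′∣ , ∣T∣ , disjT′ , disjT , (λ C C∈T′ C∈T → T∩T′ C C∈T C∈T′) , λ x y → ⇔-sym (cover x y)) ,
  (λ C C∈T′ → from (B≡A∖T∪T′ C) (inj₂ C∈T′)) , (fourA , partA) , λ C → mk⇔ (to⇒ C) (from⇒ C)
  where
  A∩T′⊆T : ∀ C → C ∈ A → C ∈ T′ → C ∈ T
  A∩T′⊆T C C∈A C∈T′ =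
    let a , b , a≢b , C∋ab = IsFourCycle⇒HasEdge (All.lookup fourA C∈A)
        D , D∈T , D∋ab = find (from (cover a b) (lose C∈T′ C∋ab))
    in subst (_∈ T) (proj₂ (partA a b a≢b) D C (T⊆A D D∈T) C∈A D∋ab C∋ab) D∈T
  to⇒ : ∀ C → C ∈ A → (C ∈ B × C ∉ T′) ⊎ C ∈ T
  to⇒ C C∈A = by-cases (C ∈ₑ? T)
    where
    by-cases : Dec (C ∈ T) → (C ∈ B × C ∉ T′) ⊎ C ∈ T
    by-cases (yes C∈T) = inj₂ C∈T
    by-cases (no C∉T) = inj₁ (from (B≡A∖T∪T′ C) (inj₁ (C∈A , C∉T)) , C∉T ∘ A∩T′⊆T C C∈A)
  from⇒ : ∀ C → (C ∈ B × C ∉ T′) ⊎ C ∈ T → C ∈ A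
  from⇒ C (inj₂ C∈T) = T⊆A C C∈T
  from⇒ C (inj₁ (C∈B , C∉T′)) = by-cases (to (B≡A∖T∪T′ C) C∈B)
    where
    by-cases : (C ∈ A × C ∉ T) ⊎ C ∈ T′ → C ∈ A
    by-cases (inj₁ (C∈A , _)) = C∈A
    by-cases (inj₂ C∈T′) = ⊥-elim (C∉T′ C∈T′)

Star-sym : ∀ {A C} → IsSystem A → Star Step A C → Star Step C A
Star-sym sysA ε = ε
Star-sym sysA (step ◅ steps) = Star-sym (IsSystem-Step step) steps ◅◅ (Step-sym sysA step ◅ ε)

Path-sym : ∀ {A B} → IsSystem A → Path A B → Path B A
Path-sym sysA (C , A→C , C≈B) = Path-respˡ-≈ C≈B (_ , Star-sym sysA A→C , ≈-refl)

preimage : (V → V) → EdgeSet → EdgeSet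
preimage g C = tabulate λ x → tabulate λ y → entry C (g x) (g y)

preimage-entry : ∀ g C x y → entry (preimage g C) x y ≡ entry C (g x) (g y)
preimage-entry g C x y = entry-tabulate (λ x y → entry C (g x) (g y)) x y

preimage-inverse : ∀ {f g} → (∀ x → g (f x) ≡ x) → ∀ C → preimage f (preimage g C) ≡ C
preimage-inverse {f} {g} g∘f≗id C = EdgeSet-ext λ x y → begin
  entry (preimage f (preimage g C)) x y ≡⟨ preimage-entry f (preimage g C) x y ⟩
  entry (preimage g C) (f x) (f y)      ≡⟨ preimage-entry g C (f x) (f y) ⟩
  entry C (g (f x)) (g (f y))           ≡⟨ cong₂ (entry C) (g∘f≗id x) (g∘f≗id y) ⟩
  entry C x y                           ∎
  where open ≡-Reasoning

relabel : Permutation′ 9 → EdgeSet → EdgeSet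
relabel π = preimage (π ⟨$⟩ˡ_)

isYes-⟨$⟩ˡ : ∀ (π : Permutation′ 9) x a → ⌊ π ⟨$⟩ˡ x ≟ a ⌋ ≡ ⌊ x ≟ π ⟨$⟩ʳ a ⌋
isYes-⟨$⟩ˡ π x a = begin
  ⌊ π ⟨$⟩ˡ x ≟ a ⌋    ≡⟨ isYes≗does _ ⟩
  does (π ⟨$⟩ˡ x ≟ a) ≡⟨ does-⇔ (mk⇔ moveʳ moveˡ) (π ⟨$⟩ˡ x ≟ a) (x ≟ π ⟨$⟩ʳ a) ⟩
  does (x ≟ π ⟨$⟩ʳ a) ≡⟨ isYes≗does _ ⟨
  ⌊ x ≟ π ⟨$⟩ʳ a ⌋    ∎
  where
  open ≡-Reasoning
  moveʳ : π ⟨$⟩ˡ x ≡ a → x ≡ π ⟨$⟩ʳ a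
  moveʳ refl = sym (inverseʳ π)
  moveˡ : x ≡ π ⟨$⟩ʳ a → π ⟨$⟩ˡ x ≡ a
  moveˡ refl = inverseˡ π

sameEdge-relabel : ∀ π x y a b →
  sameEdge (π ⟨$⟩ˡ x) (π ⟨$⟩ˡ y) a b ≡ sameEdge x y (π ⟨$⟩ʳ a) (π ⟨$⟩ʳ b)
sameEdge-relabel π x y a b
  rewrite isYes-⟨$⟩ˡ π x a | isYes-⟨$⟩ˡ π y b | isYes-⟨$⟩ˡ π x b | isYes-⟨$⟩ˡ π y a = refl

relabel-cyc : ∀ π a b c d → relabel π (cyc a b c d) ≡ cyc (π ⟨$⟩ʳ a) (π ⟨$⟩ʳ b) (π ⟨$⟩ʳ c) (π ⟨$⟩ʳ d)
relabel-cyc π a b c d = EdgeSet-ext λ x y →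
  let x′ = π ⟨$⟩ˡ x; y′ = π ⟨$⟩ˡ y
      a′ = π ⟨$⟩ʳ a; b′ = π ⟨$⟩ʳ b; c′ = π ⟨$⟩ʳ c; d′ = π ⟨$⟩ʳ d
      sE = sameEdge-relabel π x y
  in begin
  entry (relabel π (cyc a b c d)) x y
    ≡⟨ preimage-entry (π ⟨$⟩ˡ_) (cyc a b c d) x y ⟩
  entry (cyc a b c d) x′ y′
    ≡⟨ cyc-entry a b c d x′ y′ ⟩
  sameEdge x′ y′ a b ∨ sameEdge x′ y′ b c ∨ sameEdge x′ y′ c d ∨ sameEdge x′ y′ d a
    ≡⟨ cong₂ _∨_ (sE a b) (cong₂ _∨_ (sE b c) (cong₂ _∨_ (sE c d) (sE d a))) ⟩
  sameEdge x y a′ b′ ∨ sameEdge x y b′ c′ ∨ sameEdge x y c′ d′ ∨ sameEdge x y d′ a′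
    ≡⟨ cyc-entry a′ b′ c′ d′ x y ⟨
  entry (cyc a′ b′ c′ d′) x y
    ∎
  where open ≡-Reasoning

module _ (π : Permutation′ 9) where

  ∈-map-relabel : ∀ X A → X ∈ map (relabel π) A ⇔ preimage (π ⟨$⟩ʳ_) X ∈ A
  ∈-map-relabel X A = mk⇔ to′ from′
    where
    to′ : X ∈ map (relabel π) A → preimage (π ⟨$⟩ʳ_) X ∈ A
    to′ X∈πA = case ∈-map⁻ (relabel π) X∈πA of λ where
      (C , C∈A , refl) → subst (_∈ A) (sym (preimage-inverse {π ⟨$⟩ʳ_} {π ⟨$⟩ˡ_} (λ _ → inverseˡ π) C)) C∈A
    from′ : preimage (π ⟨$⟩ʳ_) X ∈ A → X ∈ map (relabel π) A
    from′ X∈A = subst (_∈ map (relabel π) A) (preimage-inverse {π ⟨$⟩ˡ_} {π ⟨$⟩ʳ_} (λ _ → inverseʳ π) X) (∈-map⁺ (relabel π) X∈A)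

  HasEdge-relabel : ∀ C x y → HasEdge (relabel π C) x y ⇔ HasEdge C (π ⟨$⟩ˡ x) (π ⟨$⟩ˡ y)
  HasEdge-relabel C x y = mk⇔ (trans (sym (preimage-entry (π ⟨$⟩ˡ_) C x y))) (trans (preimage-entry (π ⟨$⟩ˡ_) C x y))

  Covers-relabel : ∀ T x y → Covers (map (relabel π) T) x y ⇔ Covers T (π ⟨$⟩ˡ x) (π ⟨$⟩ˡ y)
  Covers-relabel T x y = mk⇔
    (λ c → Any.map (λ {C} → to (HasEdge-relabel C x y)) (Any.map⁻ {f = relabel π} {P = λ C → HasEdge C x y} {xs = T} c))
    (λ c → Any.map⁺ {f = relabel π} {P = λ C → HasEdge C x y} {xs = T} (Any.map (λ {C} → from (HasEdge-relabel C x y)) c))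

  EdgeDisjoint-relabel : ∀ {C D} → EdgeDisjoint C D → EdgeDisjoint (relabel π C) (relabel π D)
  EdgeDisjoint-relabel {C} {D} C∩D x y x∈C y∈D = C∩D _ _ (to (HasEdge-relabel C x y) x∈C) (to (HasEdge-relabel D x y) y∈D)

  ⟨$⟩ʳ-injective : ∀ {a b} → π ⟨$⟩ʳ a ≡ π ⟨$⟩ʳ b → a ≡ b
  ⟨$⟩ʳ-injective {a} {b} e = trans (sym (inverseˡ π)) (trans (cong (π ⟨$⟩ˡ_) e) (inverseˡ π))

  ⟨$⟩ˡ-injective : ∀ {a b} → π ⟨$⟩ˡ a ≡ π ⟨$⟩ˡ b → a ≡ b
  ⟨$⟩ˡ-injective {a} {b} e = trans (sym (inverseʳ π)) (trans (cong (π ⟨$⟩ʳ_) e) (inverseʳ π))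

  AllPairs-EdgeDisjoint-relabel : ∀ {A} → AllPairs EdgeDisjoint A → AllPairs EdgeDisjoint (map (relabel π) A)
  AllPairs-EdgeDisjoint-relabel disjA =
    AllPairs.map⁺ {R = EdgeDisjoint} {f = relabel π} (AllPairs.map (λ {C} {D} → EdgeDisjoint-relabel {C} {D}) disjA)

  IsFourCycle-relabel : ∀ {C} → IsFourCycle C → IsFourCycle (relabel π C)
  IsFourCycle-relabel (a , b , c , d , (a≢b , a≢c , a≢d , b≢c , b≢d , c≢d) , refl) =
    π ⟨$⟩ʳ a , π ⟨$⟩ʳ b , π ⟨$⟩ʳ c , π ⟨$⟩ʳ d ,
    (a≢b ∘ ⟨$⟩ʳ-injective , a≢c ∘ ⟨$⟩ʳ-injective , a≢d ∘ ⟨$⟩ʳ-injective ,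
     b≢c ∘ ⟨$⟩ʳ-injective , b≢d ∘ ⟨$⟩ʳ-injective , c≢d ∘ ⟨$⟩ʳ-injective) ,
    relabel-cyc π a b c d

  All-IsFourCycle-relabel : ∀ {A} → All IsFourCycle A → All IsFourCycle (map (relabel π) A)
  All-IsFourCycle-relabel fourA = All.map⁺ {P = IsFourCycle} {f = relabel π} (All.map (λ {C} → IsFourCycle-relabel {C}) fourA)

  IsSystem-relabel : ∀ {A} → IsSystem A → IsSystem (map (relabel π) A)
  IsSystem-relabel {A} (fourA , partA) = All-IsFourCycle-relabel fourA , λ x y x≢y → covered x y x≢y , unique x y x≢y
    where
    covered : ∀ x y → x ≢ y → Σ[ C ∈ EdgeSet ] (C ∈ map (relabel π) A × HasEdge C x y)
    covered x y x≢y =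
      let C , C∈A , C∋xy = proj₁ (partA _ _ (x≢y ∘ ⟨$⟩ˡ-injective))
      in relabel π C , ∈-map⁺ (relabel π) C∈A , from (HasEdge-relabel C x y) C∋xy
    unique : ∀ x y → x ≢ y → ∀ C D → C ∈ map (relabel π) A → D ∈ map (relabel π) A →
             HasEdge C x y → HasEdge D x y → C ≡ D
    unique x y x≢y C D C∈πA D∈πA = case (∈-map⁻ (relabel π) C∈πA , ∈-map⁻ (relabel π) D∈πA) of λ where
      ((C₀ , C₀∈A , refl) , (D₀ , D₀∈A , refl)) C∋xy D∋xy → cong (relabel π)
        (proj₂ (partA _ _ (x≢y ∘ ⟨$⟩ˡ-injective)) C₀ D₀ C₀∈A D₀∈A (to (HasEdge-relabel C₀ x y) C∋xy) (to (HasEdge-relabel D₀ x y) D∋xy))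

  IsBitrade-relabel : ∀ {s T T′} → IsBitrade s T T′ → IsBitrade s (map (relabel π) T) (map (relabel π) T′)
  IsBitrade-relabel {T = T} {T′} (fourT , fourT′ , ∣T∣ , ∣T′∣ , disjT , disjT′ , T∩T′ , cover) =
    All-IsFourCycle-relabel fourT , All-IsFourCycle-relabel fourT′ ,
    trans (length-map (relabel π) T) ∣T∣ , trans (length-map (relabel π) T′) ∣T′∣ ,
    AllPairs-EdgeDisjoint-relabel disjT , AllPairs-EdgeDisjoint-relabel disjT′ ,
    (λ C C∈πT C∈πT′ → T∩T′ _ (to (∈-map-relabel C T) C∈πT) (to (∈-map-relabel C T′) C∈πT′)) ,
    λ x y → ⇔-sym (Covers-relabel T′ x y) ⇔-∘ (cover _ _ ⇔-∘ Covers-relabel T x y)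

  Step-relabel : ∀ {A B} → Step A B → Step (map (relabel π) A) (map (relabel π) B)
  Step-relabel {A} {B} (s , T , T′ , vol , bitrade , T⊆A , sysB , B≡A∖T∪T′) =
    s , map (relabel π) T , map (relabel π) T′ , vol , IsBitrade-relabel bitrade ,
    (λ C C∈πT → from (∈-map-relabel C A) (T⊆A _ (to (∈-map-relabel C T) C∈πT))) , IsSystem-relabel sysB ,
    λ C → let ∈π = ∈-map-relabel C in
      ⇔-sym ((∈π A ×-⇔ ¬-cong-⇔ (∈π T)) ⊎-⇔ ∈π T′) ⇔-∘ (B≡A∖T∪T′ _ ⇔-∘ ∈π B)

  Star-relabel : ∀ {A B} → Star Step A B → Star Step (map (relabel π) A) (map (relabel π) B)
  Star-relabel = gmap (map (relabel π)) Step-relabel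

AllPairs-∈ : ∀ {A : Set} {R : A → A → Set} {xs x y} → AllPairs R xs → x ∈ xs → y ∈ xs → x ≡ y ⊎ R x y ⊎ R y x
AllPairs-∈ (_ ∷ _) (here refl) (here refl) = inj₁ refl
AllPairs-∈ (x∼xs ∷ _) (here refl) (there y∈xs) = inj₂ (inj₁ (All.lookup x∼xs y∈xs))
AllPairs-∈ (y∼xs ∷ _) (there x∈xs) (here refl) = inj₂ (inj₂ (All.lookup y∼xs x∈xs))
AllPairs-∈ (_ ∷ xs!) (there x∈xs) (there y∈xs) = AllPairs-∈ xs! x∈xs y∈xs

CoversAllEdges : CycleList → Set
CoversAllEdges A = ∀ x y → x ≢ y → Covers A x y

IsSystem-fromPartition : ∀ {A} → All IsFourCycle A → AllPairs EdgeDisjoint A → CoversAllEdges A → IsSystem A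
IsSystem-fromPartition {A} fourA disjA coverA = fourA , λ x y x≢y → find (coverA x y x≢y) , unique x y
  where
  unique : ∀ x y C D → C ∈ A → D ∈ A → HasEdge C x y → HasEdge D x y → C ≡ D
  unique x y C D C∈A D∈A C∋xy D∋xy = by-cases (AllPairs-∈ disjA C∈A D∈A)
    where
    by-cases : C ≡ D ⊎ EdgeDisjoint C D ⊎ EdgeDisjoint D C → C ≡ D
    by-cases (inj₁ C≡D) = C≡D
    by-cases (inj₂ (inj₁ C∩D)) = ⊥-elim (C∩D x y C∋xy D∋xy)
    by-cases (inj₂ (inj₂ D∩C)) = ⊥-elim (D∩C x y D∋xy C∋xy)

HasEdge? : ∀ C x y → Dec (HasEdge C x y)
HasEdge? C x y = entry C x y ≟ᵇ true

EdgeDisjoint? : ∀ C D → Dec (EdgeDisjoint C D)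
EdgeDisjoint? C D = Fin.all? λ x → Fin.all? λ y → HasEdge? C x y →-dec (HasEdge? D x y →-dec no λ ())

Covers? : ∀ T x y → Dec (Covers T x y)
Covers? T x y = any? (λ C → HasEdge? C x y) T

CoversAllEdges? : ∀ A → Dec (CoversAllEdges A)
CoversAllEdges? A = Fin.all? λ x → Fin.all? λ y → ¬? (x ≟ y) →-dec Covers? A x y

_⇔-dec_ : ∀ {P Q : Set} → Dec P → Dec Q → Dec (P ⇔ Q)
P? ⇔-dec Q? = map′ (λ (f , g) → mk⇔ f g) (λ P⇔Q → to P⇔Q , from P⇔Q) ((P? →-dec Q?) ×-dec (Q? →-dec P?))

quadCycle : Quad → EdgeSet
quadCycle (a , b , c , d) = cyc (toV a) (toV b) (toV c) (toV d)

Distinct : Quad → Set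
Distinct (a , b , c , d) =
  toV a ≢ toV b × toV a ≢ toV c × toV a ≢ toV d × toV b ≢ toV c × toV b ≢ toV d × toV c ≢ toV d

distinct? : ∀ q → Dec (Distinct q)
distinct? (a , b , c , d) =
  ¬? (toV a ≟ toV b) ×-dec ¬? (toV a ≟ toV c) ×-dec ¬? (toV a ≟ toV d) ×-dec
  ¬? (toV b ≟ toV c) ×-dec ¬? (toV b ≟ toV d) ×-dec ¬? (toV c ≟ toV d)

All-IsFourCycle-quadCycle : ∀ {qs} → All Distinct qs → All IsFourCycle (map quadCycle qs)
All-IsFourCycle-quadCycle distinct = All.map⁺ {P = IsFourCycle} {f = quadCycle} (All.map (λ {q} → fourCycle q) distinct)
  where
  fourCycle : ∀ q → Distinct q → IsFourCycle (quadCycle q)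
  fourCycle (a , b , c , d) a…d-distinct = toV a , toV b , toV c , toV d , a…d-distinct , refl

_≟q_ : (q r : Quad) → Dec (q ≡ r)
_≟q_ = Σ-≡-dec ℕ._≟_ (Σ-≡-dec ℕ._≟_ (Σ-≡-dec ℕ._≟_ ℕ._≟_))

open DecMembership _≟q_ using () renaming (_∈?_ to _∈q?_)
open DecSubset _≟q_ using () renaming (_⊆?_ to _⊆q?_)

SystemCertificate : List Quad → Set
SystemCertificate qs = All Distinct qs × AllPairs EdgeDisjoint (map quadCycle qs) × CoversAllEdges (map quadCycle qs)

systemCertificate? : ∀ qs → Dec (SystemCertificate qs)
systemCertificate? qs = All.all? distinct? qs ×-dec allPairs? EdgeDisjoint? _ ×-dec CoversAllEdges? _

IsSystem-quadCycles : ∀ {qs} → SystemCertificate qs → IsSystem (map quadCycle qs)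
IsSystem-quadCycles (distinct , disjoint , covering) = IsSystem-fromPartition (All-IsFourCycle-quadCycle distinct) disjoint covering

-- Membership is certified on quadruples (equal quadruples give equal cycles), which is far
-- cheaper to evaluate than comparing adjacency matrices; only non-membership uses the matrices.
StepCertificate : (aq bq tq tq′ : List Quad) → Set
StepCertificate aq bq tq tq′ =
  (All Distinct tq × All Distinct tq′) × (length T ≡ 3 × length T′ ≡ 3) ×
  (AllPairs EdgeDisjoint T × AllPairs EdgeDisjoint T′) × All (_∉ T′) T ×
  (∀ x y → Covers T x y ⇔ Covers T′ x y) ×
  tq ⊆ aq × tq′ ⊆ bq × All (λ q → q ∈ tq ⊎ q ∈ bq) aq × All (λ q → (q ∈ aq × quadCycle q ∉ T) ⊎ q ∈ tq′) bq
  where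
  T = map quadCycle tq
  T′ = map quadCycle tq′

stepCertificate? : ∀ aq bq tq tq′ → Dec (StepCertificate aq bq tq tq′)
stepCertificate? aq bq tq tq′ =
  (All.all? distinct? tq ×-dec All.all? distinct? tq′) ×-dec (length T ℕ.≟ 3 ×-dec length T′ ℕ.≟ 3) ×-dec
  (allPairs? EdgeDisjoint? T ×-dec allPairs? EdgeDisjoint? T′) ×-dec All.all? (λ C → ¬? (C ∈ₑ? T′)) T ×-dec
  Fin.all? (λ x → Fin.all? λ y → Covers? T x y ⇔-dec Covers? T′ x y) ×-dec
  tq ⊆q? aq ×-dec tq′ ⊆q? bq ×-dec All.all? (λ q → q ∈q? tq ⊎-dec q ∈q? bq) aq ×-dec
  All.all? (λ q → (q ∈q? aq ×-dec ¬? (quadCycle q ∈ₑ? T)) ⊎-dec q ∈q? tq′) bq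
  where
  T = map quadCycle tq
  T′ = map quadCycle tq′

certificate⇒Step : ∀ {aq bq} tq tq′ → IsSystem (map quadCycle bq) → StepCertificate aq bq tq tq′ →
                   Step (map quadCycle aq) (map quadCycle bq)
certificate⇒Step {aq} {bq} tq tq′ sysB
  ((distinctT , distinctT′) , (∣T∣ , ∣T′∣) , (disjT , disjT′) , T∩T′ , cover , tq⊆aq , tq′⊆bq , aq⊆tq∪bq , bq⊆aq∖tq∪tq′) =
  3 , T , T′ , inj₂ refl ,
  (All-IsFourCycle-quadCycle distinctT , All-IsFourCycle-quadCycle distinctT′ , ∣T∣ , ∣T′∣ , disjT , disjT′ ,
   (λ C → All.lookup T∩T′) , cover) ,
  (λ C → ⊆-map⁺ quadCycle tq⊆aq) , sysB , λ C → mk⇔ (B⊆ C) (⊆B C)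
  where
  T = map quadCycle tq
  T′ = map quadCycle tq′
  A = map quadCycle aq
  B = map quadCycle bq
  onCycles : ∀ {q} → (q ∈ aq × quadCycle q ∉ T) ⊎ q ∈ tq′ → (quadCycle q ∈ A × quadCycle q ∉ T) ⊎ quadCycle q ∈ T′
  onCycles (inj₁ (q∈aq , q∉T)) = inj₁ (∈-map⁺ quadCycle q∈aq , q∉T)
  onCycles (inj₂ q∈tq′) = inj₂ (∈-map⁺ quadCycle q∈tq′)
  B⊆ : ∀ C → C ∈ B → (C ∈ A × C ∉ T) ⊎ C ∈ T′
  B⊆ C C∈B = case ∈-map⁻ quadCycle C∈B of λ where
    (q , q∈bq , refl) → onCycles (All.lookup bq⊆aq∖tq∪tq′ q∈bq)
  ⊆B : ∀ C → (C ∈ A × C ∉ T) ⊎ C ∈ T′ → C ∈ B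
  ⊆B C (inj₂ C∈T′) = ⊆-map⁺ quadCycle tq′⊆bq C∈T′
  ⊆B C (inj₁ (C∈A , C∉T)) = case ∈-map⁻ quadCycle C∈A of λ where
    (q , q∈aq , refl) → [ ⊥-elim ∘ C∉T ∘ ∈-map⁺ quadCycle , ∈-map⁺ quadCycle ]′ (All.lookup aq⊆tq∪bq q∈aq)

S-quadCycles : ∀ i → S i ≡ map quadCycle (quads i)
S-quadCycles i = map-cong (λ { (a , b , c , d) → refl }) (quads i)

quads-certified : ∀ i → SystemCertificate (quads i)
quads-certified = toWitness {a? = Fin.all? (systemCertificate? ∘ quads)} _

S-isSystem : ∀ i → IsSystem (S i)
S-isSystem i = subst IsSystem (sym (S-quadCycles i)) (IsSystem-quadCycles (quads-certified i))

quadStep : ∀ i j tq tq′ → {True (stepCertificate? (quads i) (quads j) tq tq′)} → Step (S i) (S j)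
quadStep i j tq tq′ {certified} = subst₂ Step (sym (S-quadCycles i)) (sym (S-quadCycles j))
  (certificate⇒Step tq tq′ (IsSystem-quadCycles (quads-certified j)) (toWitness certified))

-- stepᵢⱼ goes from Sᵢ to Sⱼ in the paper's numbering, while the index k : Fin 8 denotes S_(k+1).
step₁₆ : Step (S (# 0)) (S (# 5))
step₁₆ = quadStep (# 0) (# 5)
  ((2 , 4 , 7 , 6) ∷ (6 , 8 , 7 , 9) ∷ (3 , 6 , 4 , 8) ∷ []) ((3 , 6 , 7 , 8) ∷ (2 , 4 , 8 , 6) ∷ (4 , 6 , 9 , 7) ∷ [])

step₂₅ : Step (S (# 1)) (S (# 4))
step₂₅ = quadStep (# 1) (# 4)
  ((2 , 4 , 7 , 6) ∷ (3 , 6 , 8 , 7) ∷ (3 , 8 , 4 , 9) ∷ []) ((3 , 6 , 7 , 8) ∷ (2 , 4 , 8 , 6) ∷ (3 , 7 , 4 , 9) ∷ [])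

step₃₄ : Step (S (# 2)) (S (# 3))
step₃₄ = quadStep (# 2) (# 3)
  ((3 , 8 , 5 , 9) ∷ (6 , 7 , 8 , 9) ∷ (4 , 5 , 7 , 9) ∷ []) ((4 , 5 , 8 , 9) ∷ (3 , 8 , 7 , 9) ∷ (5 , 7 , 6 , 9) ∷ [])

step₄₆ : Step (S (# 3)) (S (# 5))
step₄₆ = quadStep (# 3) (# 5)
  ((3 , 8 , 7 , 9) ∷ (3 , 6 , 4 , 7) ∷ (5 , 7 , 6 , 9) ∷ []) ((3 , 6 , 7 , 8) ∷ (4 , 6 , 9 , 7) ∷ (3 , 7 , 5 , 9) ∷ [])

step₅₆ : Step (S (# 4)) (S (# 5))
step₅₆ = quadStep (# 4) (# 5)
  ((3 , 7 , 4 , 9) ∷ (5 , 7 , 9 , 8) ∷ (4 , 5 , 9 , 6) ∷ []) ((4 , 5 , 8 , 9) ∷ (4 , 6 , 9 , 7) ∷ (3 , 7 , 5 , 9) ∷ [])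

step₇₅ : Step (S (# 6)) (S (# 4))
step₇₅ = quadStep (# 6) (# 4)
  ((3 , 6 , 9 , 8) ∷ (5 , 8 , 7 , 9) ∷ (4 , 5 , 7 , 6) ∷ []) ((3 , 6 , 7 , 8) ∷ (5 , 7 , 9 , 8) ∷ (4 , 5 , 9 , 6) ∷ [])

step₈₆ : Step (S (# 7)) (S (# 5))
step₈₆ = quadStep (# 7) (# 5)
  ((2 , 6 , 8 , 9) ∷ (1 , 8 , 4 , 9) ∷ (2 , 4 , 5 , 8) ∷ []) ((2 , 4 , 8 , 6) ∷ (4 , 5 , 8 , 9) ∷ (1 , 8 , 2 , 9) ∷ [])

S-to-S₆ : ∀ i → Star Step (S i) (S (# 5))
S-to-S₆ zero = step₁₆ ◅ ε
S-to-S₆ (suc zero) = step₂₅ ◅ step₅₆ ◅ ε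
S-to-S₆ (suc (suc zero)) = step₃₄ ◅ step₄₆ ◅ ε
S-to-S₆ (suc (suc (suc zero))) = step₄₆ ◅ ε
S-to-S₆ (suc (suc (suc (suc zero)))) = step₅₆ ◅ ε
S-to-S₆ (suc (suc (suc (suc (suc zero))))) = ε
S-to-S₆ (suc (suc (suc (suc (suc (suc zero)))))) = step₇₅ ◅ step₅₆ ◅ ε
S-to-S₆ (suc (suc (suc (suc (suc (suc (suc zero))))))) = step₈₆ ◅ ε

S-connected : ∀ i j → Star Step (S i) (S j)
S-connected i j = S-to-S₆ i ◅◅ Star-sym (S-isSystem j) (S-to-S₆ j)

Sσ-relabel : ∀ σ i → Sσ σ i ≡ map (relabel σ) (S i)
Sσ-relabel σ i = begin
  Sσ σ i                                    ≡⟨ map-cong (λ { (a , b , c , d) → sym (relabel-cyc σ (toV a) (toV b) (toV c) (toV d)) }) (quads i) ⟩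
  map (relabel σ ∘ quadCycle) (quads i)     ≡⟨ map-∘ (quads i) ⟩
  map (relabel σ) (map quadCycle (quads i)) ≡⟨ cong (map (relabel σ)) (S-quadCycles i) ⟨
  map (relabel σ) (S i)                     ∎
  where open ≡-Reasoning

Sσ-connected : ∀ σ i j → Star Step (Sσ σ i) (Sσ σ j)
Sσ-connected σ i j = subst₂ (Star Step) (sym (Sσ-relabel σ i)) (sym (Sσ-relabel σ j)) (Star-relabel σ (S-connected i j))

mainTheorem11 : (σ : Permutation′ 9) →
    (Σ[ i ∈ Fin 8 ] Path (S i) (Sσ σ i)) →
    (j : Fin 8) → Path (S j) (Sσ σ j) × Path (Sσ σ j) (S j)
mainTheorem11 σ (i , Sᵢ→Sᵢσ) j = Sⱼ→Sⱼσ , Path-sym (S-isSystem j) Sⱼ→Sⱼσ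
  where
  Sⱼ→Sⱼσ : Path (S j) (Sσ σ j)
  Sⱼ→Sⱼσ = Path-trans (Star⇒Path (S-connected j i)) (Path-trans Sᵢ→Sᵢσ (Star⇒Path (Sσ-connected σ i j)))
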